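{- Let $p\ge1$ and $n=2p+2$. With $\mathcal{C}_0,\mathcal{C}_1,\dots$ defined below for $\Delta_2^t(C_n^p)$ using the vertex order $x_j=j$, we have $\mathcal{C}_{p+1}=\{\tau\}$ where $\tau=\{1,2,\dots,p\}$.
   Context: For a graph $G$, $\Delta_2^t(G)$ is the simplicial complex whose faces are the $\sigma\subseteq V(G)$ such that $V(G)\setminus\sigma$ contains two distinct non-adjacent vertices. $C_n^p$ has vertex set $\{0,\dots,n-1\}$ with distinct $u,v$ adjacent iff $v\equiv u\pm t\pmod n$ for some $1\le t\le p$. Given vertices $x_0,\dots,x_{n-1}$, set $\mathcal{C}_0=\Delta_2^t(G)$ and for $0\le j\le n-1$ put $\mathcal{M}_{x_j}=\{\{\sigma\setminus\{x_j\},\sigma\cup\{x_j\}\}\mid \sigma\setminus\{x_j\},\sigma\cup\{x_j\}\in\mathcal{C}_j\}$ and $\mathcal{C}_{j+1}=\{\sigma\in\mathcal{C}_j\mid \sigma\text{ lies in no pair of }\mathcal{M}_{x_j}\}$. Here $G=C_n^p$ and $x_j=j$. -}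

module Defs where

open import Data.Nat using (ℕ; zero; suc; _+_; _*_; _≤_; _%_; NonZero)
open import Data.Nat.DivMod using (m%n<n)
open import Data.Fin using (Fin; toℕ; fromℕ<)
open import Data.Fin.Subset using (Subset; _∈_; _∉_; _∪_; ⁅_⁆; _-_)
open import Data.Vec using (tabulate)
open import Data.Bool using (_∧_)
open import Data.Product using (Σ; _×_; ∃; ∃-syntax)
open import Data.Sum using (_⊎_)
open import Relation.Nullary using (¬_; ⌊_⌋)
open import Relation.Binary.PropositionalEquality using (_≡_; _≢_)
open import Data.Nat using (_≤?_)

-- The graph C_n^p on vertex set Fin n (= {0,…,n-1}):
-- distinct u,v adjacent iff v ≡ u ± t (mod n) for some 1 ≤ t ≤ p.
-- "v ≡ u - t (mod n)" is written as "u ≡ v + t (mod n)".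
Adj : (n p : ℕ) → .{{_ : NonZero n}} → Fin n → Fin n → Set
Adj n p u v = u ≢ v × ∃[ t ] (1 ≤ t × t ≤ p ×
  (toℕ v ≡ (toℕ u + t) % n ⊎ toℕ u ≡ (toℕ v + t) % n))

Complex : ℕ → Set₁
Complex n = Subset n → Set

Delta2t : (n p : ℕ) → .{{_ : NonZero n}} → Complex n
Delta2t n p σ = ∃[ u ] ∃[ v ] (u ≢ v × u ∉ σ × v ∉ σ × ¬ Adj n p u v)

InMatching : ∀ {n} → Complex n → Fin n → Subset n → Set
InMatching C x σ = ∃[ ρ ] ((C (ρ - x) × C (ρ ∪ ⁅ x ⁆)) ×
  (σ ≡ ρ - x ⊎ σ ≡ ρ ∪ ⁅ x ⁆))

step : ∀ {n} → Complex n → Fin n → Complex n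
step C x σ = C σ × ¬ InMatching C x σ

-- The vertex x_j = j (taken mod n; only j < n is ever used below).
vtx : (n : ℕ) → .{{_ : NonZero n}} → ℕ → Fin n
vtx n j = fromℕ< (m%n<n j n)

𝒞 : (n p : ℕ) → .{{_ : NonZero n}} → ℕ → Complex n
𝒞 n p zero = Delta2t n p
𝒞 n p (suc j) = step (𝒞 n p j) (vtx n j)

τ : (n p : ℕ) → Subset n
τ n p = tabulate (λ i → ⌊ 1 ≤? toℕ i ⌋ ∧ ⌊ toℕ i ≤? p ⌋)

-- In C_n^p with n = 2m, m = p + 1, two distinct vertices are non-adjacent exactly when they
-- are antipodal, so the faces of Δ₂ᵗ are the sets missing some antipodal pair {i, i + m}.
-- Matching along x₀ = 0 removes every face that also misses a pair other than {0, m}.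
-- Inductively, for 1 ≤ k ≤ m, 𝒞ₖ consists of the σ that miss {0, m}, contain i but not i + m
-- for 1 ≤ i < k, and meet every pair {i, i + m} with i ≥ k: matching along xₖ = k removes
-- exactly the σ with k + m ∈ σ, since then σ ∖ k and σ ∪ k both lie in 𝒞ₖ.  For k = m every
-- pair is decided and the only survivor is {1, …, p}.

module Submission where

open import Defs
open import Data.Nat using (ℕ; suc; _*_; _+_; _≤_)
open import Data.Fin.Subset using (Subset)
open import Function.Bundles using (_⇔_)
open import Relation.Binary.PropositionalEquality using (_≡_)

open import Data.Bool using (T; true; _∧_)
open import Data.Bool.Properties using (T-≡; T-∧)
open import Data.Empty using (⊥-elim)
open import Data.Fin using (Fin; toℕ; fromℕ<) renaming (_≟_ to _≟ᶠ_)
open import Data.Fin.Properties using (toℕ-fromℕ<; toℕ-injective; toℕ<n)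
open import Data.Fin.Subset using (_∈_; _∉_; _-_; _─_; _∪_; ⁅_⁆; outside)
open import Data.Fin.Subset.Properties
  using (_∈?_; ⊆-antisym; p─q⊆p; x∈p∧x≢y⇒x∈p-y; x∈p∪q⁻; x∈p∪q⁺; x∈⁅x⁆; x∈⁅y⁆⇒x≡y)
open import Data.Nat using (zero; _<_; _%_; _/_; _∸_; _≤?_; _<?_; s≤s; s≤s⁻¹; z<s)
open import Data.Nat.Divisibility using (divides; >⇒∤)
open import Data.Nat.DivMod using (m≡m%n+[m/n]*n; m<n⇒m%n≡m; [m+n]%n≡m%n)
open import Data.Nat.Properties
open import Data.Product using (_×_; _,_; ∃-syntax; proj₁; proj₂)
open import Data.Product.Function.NonDependent.Propositional using (_×-⇔_)
open import Data.Sum using (_⊎_; inj₁; inj₂; [_,_]′)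
import Data.Sum as Sum
open import Data.Vec using (_∷_; here; there; lookup)
open import Data.Vec.Properties using (lookup⇒[]=; []=⇒lookup; lookup∘tabulate)
open import Function using (_∘_; id)
open import Level using (0ℓ)
open import Function.Bundles using (mk⇔; Equivalence)
import Function.Properties.Equivalence as ⇔
open import Function.Related.TypeIsomorphisms using (¬-cong-⇔)
open import Relation.Binary.Definitions using (Tri; tri<; tri≈; tri>)
open import Relation.Binary.PropositionalEquality
  using (module ≡-Reasoning; refl; sym; trans; cong; subst; subst₂; _≢_)
open import Relation.Nullary using (¬_; Dec; yes; no)
open import Relation.Nullary.Decidable using (⌊_⌋; toWitness; fromWitness)
import Relation.Binary.Reasoning.Setoid as SetoidReasoning

open Equivalence using (to; from)
module ⇔-Reasoning = SetoidReasoning (⇔.⇔-setoid 0ℓ)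

x∈p─q⇒x∉q : ∀ {n} {x : Fin n} (p q : Subset n) → x ∈ p ─ q → x ∉ q
x∈p─q⇒x∉q (_ ∷ p) (outside ∷ q) here ()
x∈p─q⇒x∉q (_ ∷ p) (_ ∷ q) (there x∈p─q) (there x∈q) = x∈p─q⇒x∉q p q x∈p─q x∈q

module _ {n : ℕ} where

  x∉p-x : ∀ (p : Subset n) x → x ∉ p - x
  x∉p-x p x x∈p-x = x∈p─q⇒x∉q p ⁅ x ⁆ x∈p-x (x∈⁅x⁆ x)

  x∈p∪⁅x⁆ : ∀ (p : Subset n) x → x ∈ p ∪ ⁅ x ⁆
  x∈p∪⁅x⁆ p x = x∈p∪q⁺ (inj₂ (x∈⁅x⁆ x))

  ∉p∪⁅x⁆ : ∀ {p : Subset n} {x y} → y ∉ p ∪ ⁅ x ⁆ → y ∉ p × y ≢ x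
  ∉p∪⁅x⁆ {p} y∉p∪x = y∉p∪x ∘ x∈p∪q⁺ ∘ inj₁ , λ { refl → y∉p∪x (x∈p∪⁅x⁆ p _) }

  subset-ext : {p q : Subset n} → (∀ y → y ∈ p ⇔ y ∈ q) → p ≡ q
  subset-ext p⇔q = ⊆-antisym (λ {y} → to (p⇔q y)) (λ {y} → from (p⇔q y))

  AgreeOff : Fin n → Subset n → Subset n → Set
  AgreeOff x p q = ∀ {y} → y ≢ x → y ∈ p ⇔ y ∈ q

  agreeOff-sym : ∀ {x p q} → AgreeOff x p q → AgreeOff x q p
  agreeOff-sym agree y≢x = ⇔.sym (agree y≢x)

  p-x-agreeOff : ∀ p x → AgreeOff x p (p - x)
  p-x-agreeOff p x y≢x = mk⇔ (λ y∈p → x∈p∧x≢y⇒x∈p-y y∈p y≢x) (p─q⊆p p ⁅ x ⁆)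

  p∪⁅x⁆-agreeOff : ∀ p x → AgreeOff x p (p ∪ ⁅ x ⁆)
  p∪⁅x⁆-agreeOff p x {y} y≢x =
    mk⇔ (x∈p∪q⁺ ∘ inj₁) (λ y∈ → [ id , ⊥-elim ∘ y≢x ∘ x∈⁅y⁆⇒x≡y x ]′ (x∈p∪q⁻ p ⁅ x ⁆ y∈))

  ∈-agreeOff : ∀ {x p q y} → AgreeOff x p q → y ≢ x → y ∈ p → y ∈ q
  ∈-agreeOff agree y≢x = to (agree y≢x)

  ∉-agreeOff : ∀ {x p q y} → AgreeOff x p q → y ≢ x → y ∉ p → y ∉ q
  ∉-agreeOff agree y≢x y∉p = y∉p ∘ from (agree y≢x)

  agreeOff-ext : ∀ {x p q} → AgreeOff x p q → (x ∈ p ⇔ x ∈ q) → p ≡ q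
  agreeOff-ext {x} {p} {q} agree at-x = subset-ext agree-everywhere
    where
    agree-everywhere : ∀ y → y ∈ p ⇔ y ∈ q
    agree-everywhere y with y ≟ᶠ x
    ... | yes refl = at-x
    ... | no y≢x = agree y≢x

  agreeOff⇒p-x≡q-x : ∀ {x p q} → AgreeOff x p q → p - x ≡ q - x
  agreeOff⇒p-x≡q-x {x} {p} {q} agree = agreeOff-ext
    (λ y≢x → ⇔.trans (⇔.sym (p-x-agreeOff p x y≢x)) (⇔.trans (agree y≢x) (p-x-agreeOff q x y≢x)))
    (mk⇔ (⊥-elim ∘ x∉p-x p x) (⊥-elim ∘ x∉p-x q x))

  agreeOff⇒p∪⁅x⁆≡q∪⁅x⁆ : ∀ {x p q} → AgreeOff x p q → p ∪ ⁅ x ⁆ ≡ q ∪ ⁅ x ⁆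
  agreeOff⇒p∪⁅x⁆≡q∪⁅x⁆ {x} {p} {q} agree = agreeOff-ext
    (λ y≢x → ⇔.trans (⇔.sym (p∪⁅x⁆-agreeOff p x y≢x)) (⇔.trans (agree y≢x) (p∪⁅x⁆-agreeOff q x y≢x)))
    (mk⇔ (λ _ → x∈p∪⁅x⁆ q x) (λ _ → x∈p∪⁅x⁆ p x))

  x∉p⇒p-x≡p : ∀ {x p} → x ∉ p → p - x ≡ p
  x∉p⇒p-x≡p {x} {p} x∉p =
    agreeOff-ext (agreeOff-sym (p-x-agreeOff p x)) (mk⇔ (⊥-elim ∘ x∉p-x p x) (⊥-elim ∘ x∉p))

  x∈p⇒p∪⁅x⁆≡p : ∀ {x p} → x ∈ p → p ∪ ⁅ x ⁆ ≡ p
  x∈p⇒p∪⁅x⁆≡p {x} {p} x∈p =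
    agreeOff-ext (agreeOff-sym (p∪⁅x⁆-agreeOff p x)) (mk⇔ (λ _ → x∈p) (λ _ → x∈p∪⁅x⁆ p x))

  Unmatched : Complex n → Fin n → Complex n
  Unmatched C x σ = C σ × ¬ (C (σ - x) × C (σ ∪ ⁅ x ⁆))

  inMatching⇔ : ∀ (C : Complex n) x σ → InMatching C x σ ⇔ (C (σ - x) × C (σ ∪ ⁅ x ⁆))
  inMatching⇔ C x σ = mk⇔ faces-of-pair pair-of-faces
    where
    faces-of-pair : InMatching C x σ → C (σ - x) × C (σ ∪ ⁅ x ⁆)
    faces-of-pair (ρ , (C[ρ-x] , C[ρ∪x]) , σ∈pair) =
      subst C (sym (agreeOff⇒p-x≡q-x σ≈ρ)) C[ρ-x] , subst C (sym (agreeOff⇒p∪⁅x⁆≡q∪⁅x⁆ σ≈ρ)) C[ρ∪x]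
      where
      σ≈ρ : AgreeOff x σ ρ
      σ≈ρ = [ (λ σ≡ρ-x → subst (λ s → AgreeOff x s ρ) (sym σ≡ρ-x) (agreeOff-sym (p-x-agreeOff ρ x)))
            , (λ σ≡ρ∪x → subst (λ s → AgreeOff x s ρ) (sym σ≡ρ∪x) (agreeOff-sym (p∪⁅x⁆-agreeOff ρ x)))
            ]′ σ∈pair
    pair-of-faces : C (σ - x) × C (σ ∪ ⁅ x ⁆) → InMatching C x σ
    pair-of-faces faces with x ∈? σ
    ... | yes x∈σ = σ , faces , inj₂ (sym (x∈p⇒p∪⁅x⁆≡p x∈σ))
    ... | no x∉σ = σ , faces , inj₁ (sym (x∉p⇒p-x≡p x∉σ))

  step⇔Unmatched : ∀ {C D : Complex n} x → (∀ ρ → C ρ ⇔ D ρ) → ∀ σ → step C x σ ⇔ Unmatched D x σ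
  step⇔Unmatched {C} x C⇔D σ =
    C⇔D σ ×-⇔ ¬-cong-⇔ (⇔.trans (inMatching⇔ C x σ) (C⇔D (σ - x) ×-⇔ C⇔D (σ ∪ ⁅ x ⁆)))

∈τ⇔ : ∀ {n} p (w : Fin n) → w ∈ τ n p ⇔ (1 ≤ toℕ w × toℕ w ≤ p)
∈τ⇔ {n} p w = begin
  w ∈ τ n p                                  ≈⟨ mk⇔ []=⇒lookup (lookup⇒[]= w (τ n p)) ⟩
  lookup (τ n p) w ≡ true                    ≡⟨ cong (_≡ true) (lookup∘tabulate _ w) ⟩
  (⌊ 1 ≤? toℕ w ⌋ ∧ ⌊ toℕ w ≤? p ⌋) ≡ true   ≈⟨ ⇔.sym T-≡ ⟩
  T (⌊ 1 ≤? toℕ w ⌋ ∧ ⌊ toℕ w ≤? p ⌋)        ≈⟨ T-∧ ⟩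
  (T ⌊ 1 ≤? toℕ w ⌋ × T ⌊ toℕ w ≤? p ⌋)      ≈⟨ mk⇔ toWitness fromWitness ×-⇔ mk⇔ toWitness fromWitness ⟩
  (1 ≤ toℕ w × toℕ w ≤ p)                    ∎
  where open ⇔-Reasoning

module Antipodes (p : ℕ) where

  m N : ℕ
  m = suc p
  N = suc (suc (2 * p))

  N≡m+m : N ≡ m + m
  N≡m+m = cong suc (trans (cong (suc ∘ (p +_)) (+-identityʳ p)) (sym (+-suc p p)))

  Antipodal : Fin N → Fin N → Set
  Antipodal u v = toℕ v ≡ toℕ u + m

  antipodal? : ∀ u v → Dec (Antipodal u v)
  antipodal? u v = toℕ v ≟ toℕ u + m

  antipodal⇒<m : ∀ {u v} → Antipodal u v → toℕ u < m
  antipodal⇒<m {u} {v} v≡u+m = +-cancelʳ-< m (toℕ u) m (subst₂ _<_ v≡u+m N≡m+m (toℕ<n v))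

  antipodal⇒≥m : ∀ {u v} → Antipodal u v → m ≤ toℕ v
  antipodal⇒≥m {u} v≡u+m = subst (m ≤_) (sym v≡u+m) (m≤n+m m (toℕ u))

  antipodal⇒≢ : ∀ {u v} → Antipodal u v → u ≢ v
  antipodal⇒≢ {u} v≡u+m refl = n≮n (toℕ u) (≤-trans (antipodal⇒<m v≡u+m) (antipodal⇒≥m v≡u+m))

  antipodal-unique : ∀ {u v u′ v′} → Antipodal u v → Antipodal u′ v′ → toℕ u ≡ toℕ u′ → u ≡ u′ × v ≡ v′
  antipodal-unique v≡u+m v′≡u′+m u≡u′ =
    toℕ-injective u≡u′ , toℕ-injective (trans v≡u+m (trans (cong (_+ m) u≡u′) (sym v′≡u′+m)))

  antipode : ∀ u → toℕ u < m → ∃[ v ] Antipodal u v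
  antipode u u<m = fromℕ< u+m<N , toℕ-fromℕ< u+m<N
    where
    u+m<N : toℕ u + m < N
    u+m<N = subst (toℕ u + m <_) (sym N≡m+m) (+-monoˡ-< m u<m)

  antipode⁻¹ : ∀ v → m ≤ toℕ v → ∃[ u ] Antipodal u v
  antipode⁻¹ v m≤v = fromℕ< v∸m<N , trans (sym (m∸n+n≡m m≤v)) (cong (_+ m) (sym (toℕ-fromℕ< v∸m<N)))
    where
    v∸m<N : toℕ v ∸ m < N
    v∸m<N = ≤-<-trans (m∸n≤m (toℕ v) m) (toℕ<n v)

  pair-of : ∀ w → ∃[ u ] ∃[ v ] (Antipodal u v × (w ≡ u ⊎ w ≡ v))
  pair-of w with toℕ w <? m
  ... | yes w<m = let (v , a) = antipode w w<m in w , v , a , inj₁ refl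
  ... | no w≮m = let (u , a) = antipode⁻¹ w (≮⇒≥ w≮m) in u , w , a , inj₂ refl

  Adj-sym : ∀ {u v} → Adj N p u v → Adj N p v u
  Adj-sym (u≢v , t , 1≤t , t≤p , shift) = u≢v ∘ sym , t , 1≤t , t≤p , [ inj₂ , inj₁ ]′ shift

  %-residue : ∀ {a r} → r ≡ a % N → a ≡ r + a / N * N
  %-residue {a} r≡a%N = trans (m≡m%n+[m/n]*n a N) (cong (_+ a / N * N) (sym r≡a%N))

  antipodal⇒¬Adj : ∀ {u v} → Antipodal u v → ¬ Adj N p u v
  antipodal⇒¬Adj {u} {v} v≡u+m (_ , t , _ , t≤p , inj₁ v≡[u+t]%N) =
    1+n≰n (≤-trans (m≤m+n m _) (≤-trans (≤-reflexive (sym t≡m+qN)) t≤p))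
    where
    t≡m+qN : t ≡ m + (toℕ u + t) / N * N
    t≡m+qN = +-cancelˡ-≡ (toℕ u) t _
      (trans (%-residue v≡[u+t]%N) (trans (cong (_+ _) v≡u+m) (+-assoc (toℕ u) m _)))
  antipodal⇒¬Adj {u} {v} v≡u+m (_ , t , _ , t≤p , inj₂ u≡[v+t]%N) =
    >⇒∤ m+t<N (divides ((toℕ v + t) / N) m+t≡qN)
    where
    m+t≡qN : m + t ≡ (toℕ v + t) / N * N
    m+t≡qN = +-cancelˡ-≡ (toℕ u) _ _ (begin
      toℕ u + (m + t)               ≡⟨ +-assoc (toℕ u) m t ⟨
      toℕ u + m + t                 ≡⟨ cong (_+ t) v≡u+m ⟨
      toℕ v + t                     ≡⟨ %-residue u≡[v+t]%N ⟩
      toℕ u + (toℕ v + t) / N * N   ∎)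
      where open ≡-Reasoning
    m+t<N : m + t < N
    m+t<N = subst (m + t <_) (sym N≡m+m) (+-monoʳ-< m (s≤s t≤p))

  adjacent : ∀ {u v} → toℕ u < toℕ v → ¬ Antipodal u v → Adj N p u v
  adjacent {u} {v} u<v ¬antipodal = (λ u≡v → <⇒≢ u<v (cong toℕ u≡v)) , by-distance (<-cmp d m)
    where
    d = toℕ v ∸ toℕ u
    u+d≡v : toℕ u + d ≡ toℕ v
    u+d≡v = m+[n∸m]≡n (<⇒≤ u<v)
    d<N : d < N
    d<N = ≤-<-trans (m∸n≤m (toℕ v) (toℕ u)) (toℕ<n v)
    by-distance : Tri (d < m) (d ≡ m) (m < d) →
                  ∃[ t ] (1 ≤ t × t ≤ p × (toℕ v ≡ (toℕ u + t) % N ⊎ toℕ u ≡ (toℕ v + t) % N))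
    by-distance (tri< d<m _ _) = d , m<n⇒0<n∸m u<v , s≤s⁻¹ d<m ,
      inj₁ (sym (trans (cong (_% N) u+d≡v) (m<n⇒m%n≡m (toℕ<n v))))
    by-distance (tri≈ _ d≡m _) = ⊥-elim (¬antipodal (trans (sym u+d≡v) (cong (toℕ u +_) d≡m)))
    by-distance (tri> _ _ m<d) = N ∸ d , m<n⇒0<n∸m d<N , m≤n+o⇒m∸n≤o N d N≤d+p ,
      inj₂ (sym (begin
        (toℕ v + (N ∸ d)) % N        ≡⟨ cong (λ b → (b + (N ∸ d)) % N) u+d≡v ⟨
        (toℕ u + d + (N ∸ d)) % N    ≡⟨ cong (_% N) (+-assoc (toℕ u) d (N ∸ d)) ⟩
        (toℕ u + (d + (N ∸ d))) % N  ≡⟨ cong (λ k → (toℕ u + k) % N) (m+[n∸m]≡n (<⇒≤ d<N)) ⟩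
        (toℕ u + N) % N              ≡⟨ [m+n]%n≡m%n (toℕ u) N ⟩
        toℕ u % N                    ≡⟨ m<n⇒m%n≡m (toℕ<n u) ⟩
        toℕ u                        ∎))
      where
      open ≡-Reasoning
      N≤d+p : N ≤ d + p
      N≤d+p = subst (_≤ d + p) (cong (λ k → suc (suc (p + k))) (sym (+-identityʳ p))) (+-monoˡ-≤ p m<d)

  MissesPair : Complex N
  MissesPair σ = ∃[ u ] ∃[ v ] (Antipodal u v × u ∉ σ × v ∉ σ)

  Delta2t⇔MissesPair : ∀ σ → Delta2t N p σ ⇔ MissesPair σ
  Delta2t⇔MissesPair σ = mk⇔ antipodal-non-face
    (λ (u , v , a , u∉σ , v∉σ) → u , v , antipodal⇒≢ a , u∉σ , v∉σ , antipodal⇒¬Adj a)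
    where
    antipodal-non-face : Delta2t N p σ → MissesPair σ
    antipodal-non-face (u , v , u≢v , u∉σ , v∉σ , ¬adj) with antipodal? u v | antipodal? v u
    ... | yes a | _ = u , v , a , u∉σ , v∉σ
    ... | no _  | yes a = v , u , a , v∉σ , u∉σ
    ... | no ¬a | no ¬a′ with <-cmp (toℕ u) (toℕ v)
    ...   | tri< u<v _ _ = ⊥-elim (¬adj (adjacent u<v ¬a))
    ...   | tri≈ _ u≡v _ = ⊥-elim (u≢v (toℕ-injective u≡v))
    ...   | tri> _ _ v<u = ⊥-elim (¬adj (Adj-sym (adjacent v<u ¬a′)))

  record Stage (k : ℕ) (σ : Subset N) : Set where
    field
      base    : ∀ {u v} → Antipodal u v → toℕ u ≡ 0 → u ∉ σ × v ∉ σ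
      settled : ∀ {u v} → Antipodal u v → 1 ≤ toℕ u → toℕ u < k → u ∈ σ × v ∉ σ
      covered : ∀ {u v} → Antipodal u v → k ≤ toℕ u → u ∈ σ ⊎ v ∈ σ

  ≢-by-index : ∀ {u x : Fin N} → toℕ u ≢ toℕ x → u ≢ x
  ≢-by-index u≢x = u≢x ∘ cong toℕ

  antipode≢ : ∀ {u v x} → Antipodal u v → toℕ x < m → v ≢ x
  antipode≢ a x<m refl = <⇒≱ x<m (antipodal⇒≥m a)

  stage₁⇔ : ∀ x → toℕ x ≡ 0 → ∀ σ → Unmatched MissesPair x σ ⇔ Stage 1 σ
  stage₁⇔ x x≡0 σ = mk⇔ stage₁ unmatched
    where
    x<m : toℕ x < m
    x<m = subst (_< m) (sym x≡0) z<s
    ≢x : ∀ {u} → toℕ u ≢ 0 → u ≢ x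
    ≢x u≢0 = ≢-by-index (λ u≡x → u≢0 (trans u≡x x≡0))
    stage₁ : Unmatched MissesPair x σ → Stage 1 σ
    stage₁ ((u₀ , v₀ , a₀ , u₀∉σ , v₀∉σ) , ¬both) = record
      { base    = λ a u≡0 → let (u≡u₀ , v≡v₀) = antipodal-unique a a₀ (trans u≡0 (sym u₀≡0)) in
                  subst (_∉ σ) (sym u≡u₀) u₀∉σ , subst (_∉ σ) (sym v≡v₀) v₀∉σ
      ; settled = λ _ 1≤u u<1 → ⊥-elim (<⇒≱ u<1 1≤u)
      ; covered = cover
      }
      where
      only-base : ∀ {u v} → Antipodal u v → u ∉ σ → v ∉ σ → toℕ u ≡ 0
      only-base {u} a u∉σ v∉σ with toℕ u ≟ 0
      ... | yes u≡0 = u≡0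
      ... | no u≢0 = ⊥-elim (¬both (missed (p-x-agreeOff σ x) , missed (p∪⁅x⁆-agreeOff σ x)))
        where
        missed : ∀ {ρ} → AgreeOff x σ ρ → MissesPair ρ
        missed σ≈ρ = u , _ , a , ∉-agreeOff σ≈ρ (≢x u≢0) u∉σ , ∉-agreeOff σ≈ρ (antipode≢ a x<m) v∉σ
      u₀≡0 : toℕ u₀ ≡ 0
      u₀≡0 = only-base a₀ u₀∉σ v₀∉σ
      cover : ∀ {u v} → Antipodal u v → 1 ≤ toℕ u → u ∈ σ ⊎ v ∈ σ
      cover {u} {v} a 1≤u with u ∈? σ | v ∈? σ
      ... | yes u∈σ | _ = inj₁ u∈σ
      ... | no _ | yes v∈σ = inj₂ v∈σ
      ... | no u∉σ | no v∉σ = ⊥-elim (<⇒≢ 1≤u (sym (only-base a u∉σ v∉σ)))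
    unmatched : Stage 1 σ → Unmatched MissesPair x σ
    unmatched st = missing-base , λ (_ , missed-with-x) → no-pair-missed missed-with-x
      where
      missing-base : MissesPair σ
      missing-base = let (x̄ , a) = antipode x x<m in x , x̄ , a , Stage.base st a x≡0
      no-pair-missed : ¬ MissesPair (σ ∪ ⁅ x ⁆)
      no-pair-missed (u , v , a , u∉σ∪x , v∉σ∪x) =
        let (u∉σ , u≢x) = ∉p∪⁅x⁆ u∉σ∪x
            u≢0 = λ u≡0 → u≢x (toℕ-injective (trans u≡0 (sym x≡0)))
        in [ u∉σ , proj₁ (∉p∪⁅x⁆ v∉σ∪x) ]′ (Stage.covered st a (n≢0⇒n>0 u≢0))

  module _ {k} {x x̄ : Fin N} (1≤k : 1 ≤ k) (x≡k : toℕ x ≡ k) (ax : Antipodal x x̄) where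

    private
      x<m : toℕ x < m
      x<m = antipodal⇒<m ax
      k≤x : k ≤ toℕ x
      k≤x = ≤-reflexive (sym x≡k)
      ≢x : ∀ {u} → toℕ u ≢ k → u ≢ x
      ≢x u≢k = ≢-by-index (λ u≡x → u≢k (trans u≡x x≡k))
      pair-of-x : ∀ {u v} → Antipodal u v → toℕ u ≡ k → u ≡ x × v ≡ x̄
      pair-of-x a u≡k = antipodal-unique a ax (trans u≡k (sym x≡k))

    -- Once x̄ ∈ σ covers the pair of x, membership of x is irrelevant to Stage k.
    stage-agreeOff : ∀ {σ ρ} → Stage k σ → x̄ ∈ σ → AgreeOff x σ ρ → Stage k ρ
    stage-agreeOff {σ} {ρ} st x̄∈σ σ≈ρ = record
      { base    = λ a u≡0 → let (u∉σ , v∉σ) = Stage.base st a u≡0 in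
                  ∉-agreeOff σ≈ρ (≢x (λ u≡k → <⇒≢ 1≤k (trans (sym u≡0) u≡k))) u∉σ ,
                  ∉-agreeOff σ≈ρ (antipode≢ a x<m) v∉σ
      ; settled = λ a 1≤u u<k → let (u∈σ , v∉σ) = Stage.settled st a 1≤u u<k in
                  ∈-agreeOff σ≈ρ (≢x (<⇒≢ u<k)) u∈σ , ∉-agreeOff σ≈ρ (antipode≢ a x<m) v∉σ
      ; covered = cover
      }
      where
      cover : ∀ {u v} → Antipodal u v → k ≤ toℕ u → u ∈ ρ ⊎ v ∈ ρ
      cover {u} a k≤u with toℕ u ≟ k
      ... | yes u≡k =
        inj₂ (subst (_∈ ρ) (sym (proj₂ (pair-of-x a u≡k))) (∈-agreeOff σ≈ρ (antipode≢ ax x<m) x̄∈σ))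
      ... | no u≢k =
        Sum.map (∈-agreeOff σ≈ρ (≢x u≢k)) (∈-agreeOff σ≈ρ (antipode≢ a x<m)) (Stage.covered st a k≤u)

    unmatched⇒stage-suc : ∀ {σ} → Unmatched (Stage k) x σ → Stage (suc k) σ
    unmatched⇒stage-suc {σ} (st , ¬both) = record
      { base    = Stage.base st
      ; settled = settle
      ; covered = λ a k<u → Stage.covered st a (<⇒≤ k<u)
      }
      where
      x̄∉σ : x̄ ∉ σ
      x̄∉σ x̄∈σ =
        ¬both (stage-agreeOff st x̄∈σ (p-x-agreeOff σ x) , stage-agreeOff st x̄∈σ (p∪⁅x⁆-agreeOff σ x))
      x∈σ : x ∈ σ
      x∈σ = [ id , ⊥-elim ∘ x̄∉σ ]′ (Stage.covered st ax k≤x)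
      settle : ∀ {u v} → Antipodal u v → 1 ≤ toℕ u → toℕ u < suc k → u ∈ σ × v ∉ σ
      settle {u} a 1≤u u≤k with toℕ u ≟ k
      ... | yes u≡k = let (u≡x , v≡x̄) = pair-of-x a u≡k in
                      subst (_∈ σ) (sym u≡x) x∈σ , subst (_∉ σ) (sym v≡x̄) x̄∉σ
      ... | no u≢k = Stage.settled st a 1≤u (≤∧≢⇒< (s≤s⁻¹ u≤k) u≢k)

    stage-suc⇒unmatched : ∀ {σ} → Stage (suc k) σ → Unmatched (Stage k) x σ
    stage-suc⇒unmatched {σ} st′ =
      st , λ (st₋ , _) → [ x∉p-x σ x , x̄∉σ ∘ p─q⊆p σ ⁅ x ⁆ ]′ (Stage.covered st₋ ax k≤x)
      where
      x̄∉σ : x̄ ∉ σ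
      x̄∉σ = proj₂ (Stage.settled st′ ax (≤-trans 1≤k k≤x) (s≤s (≤-reflexive x≡k)))
      cover : ∀ {u v} → Antipodal u v → k ≤ toℕ u → u ∈ σ ⊎ v ∈ σ
      cover {u} a k≤u with toℕ u ≟ k
      ... | yes u≡k = inj₁ (proj₁ (Stage.settled st′ a (≤-trans 1≤k k≤u) (s≤s (≤-reflexive u≡k))))
      ... | no u≢k = Stage.covered st′ a (≤∧≢⇒< k≤u (u≢k ∘ sym))
      st : Stage k σ
      st = record
        { base    = Stage.base st′
        ; settled = λ a 1≤u u<k → Stage.settled st′ a 1≤u (m<n⇒m<1+n u<k)
        ; covered = cover
        }

  stage-suc⇔ : ∀ {k} x → 1 ≤ k → toℕ x ≡ k → k < m → ∀ σ → Unmatched (Stage k) x σ ⇔ Stage (suc k) σ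
  stage-suc⇔ x 1≤k x≡k k<m σ with antipode x (subst (_< m) (sym x≡k) k<m)
  ... | x̄ , ax = mk⇔ (unmatched⇒stage-suc 1≤k x≡k ax) (stage-suc⇒unmatched 1≤k x≡k ax)

  antipode∉τ : ∀ {u v} → Antipodal u v → v ∉ τ N p
  antipode∉τ a v∈τ = 1+n≰n (≤-trans (antipodal⇒≥m a) (proj₂ (to (∈τ⇔ p _) v∈τ)))

  ∈τ⇔≢0 : ∀ {u v} → Antipodal u v → u ∈ τ N p ⇔ toℕ u ≢ 0
  ∈τ⇔≢0 a = mk⇔ (λ u∈τ u≡0 → <⇒≢ (proj₁ (to (∈τ⇔ p _) u∈τ)) (sym u≡0))
                (λ u≢0 → from (∈τ⇔ p _) (n≢0⇒n>0 u≢0 , s≤s⁻¹ (antipodal⇒<m a)))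

  stage-final⇔ : ∀ σ → Stage m σ ⇔ σ ≡ τ N p
  stage-final⇔ σ = mk⇔ (λ st → subset-ext (agrees-with-τ st)) (λ { refl → stage-τ })
    where
    agrees-on-pair : Stage m σ → ∀ {u v} → Antipodal u v → (u ∈ σ ⇔ u ∈ τ N p) × (v ∈ σ ⇔ v ∈ τ N p)
    agrees-on-pair st {u} a with toℕ u ≟ 0
    ... | yes u≡0 = let (u∉σ , v∉σ) = Stage.base st a u≡0 in
      mk⇔ (⊥-elim ∘ u∉σ) (λ u∈τ → ⊥-elim (to (∈τ⇔≢0 a) u∈τ u≡0)) , mk⇔ (⊥-elim ∘ v∉σ) (⊥-elim ∘ antipode∉τ a)
    ... | no u≢0 = let (u∈σ , v∉σ) = Stage.settled st a (n≢0⇒n>0 u≢0) (antipodal⇒<m a) in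
      mk⇔ (λ _ → from (∈τ⇔≢0 a) u≢0) (λ _ → u∈σ) , mk⇔ (⊥-elim ∘ v∉σ) (⊥-elim ∘ antipode∉τ a)
    agrees-with-τ : Stage m σ → ∀ w → w ∈ σ ⇔ w ∈ τ N p
    agrees-with-τ st w with pair-of w
    ... | u , v , a , inj₁ refl = proj₁ (agrees-on-pair st a)
    ... | u , v , a , inj₂ refl = proj₂ (agrees-on-pair st a)
    stage-τ : Stage m (τ N p)
    stage-τ = record
      { base    = λ a u≡0 → (λ u∈τ → to (∈τ⇔≢0 a) u∈τ u≡0) , antipode∉τ a
      ; settled = λ a 1≤u _ → from (∈τ⇔≢0 a) (<⇒≢ 1≤u ∘ sym) , antipode∉τ a
      ; covered = λ a m≤u → ⊥-elim (<⇒≱ (antipodal⇒<m a) m≤u)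
      }

  toℕ-vtx : ∀ {j} → j < N → toℕ (vtx N j) ≡ j
  toℕ-vtx j<N = trans (toℕ-fromℕ< _) (m<n⇒m%n≡m j<N)

  𝒞⇔Stage : ∀ j → j < m → ∀ σ → 𝒞 N p (suc j) σ ⇔ Stage (suc j) σ
  𝒞⇔Stage zero _ σ =
    ⇔.trans (step⇔Unmatched (vtx N 0) Delta2t⇔MissesPair σ) (stage₁⇔ (vtx N 0) (toℕ-vtx z<s) σ)
  𝒞⇔Stage (suc j) j+1<m σ =
    ⇔.trans (step⇔Unmatched (vtx N (suc j)) (𝒞⇔Stage j (<-trans (n<1+n j) j+1<m)) σ)
            (stage-suc⇔ (vtx N (suc j)) z<s (toℕ-vtx (<-≤-trans j+1<m m≤N)) j+1<m σ)
    where
    m≤N : m ≤ N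
    m≤N = subst (m ≤_) (sym N≡m+m) (m≤m+n m m)

lemma3p4 : (p : ℕ) → 1 ≤ p → (σ : Subset (suc (suc (2 * p)))) →
    (𝒞 (suc (suc (2 * p))) p (p + 1) σ ⇔ σ ≡ τ (suc (suc (2 * p))) p)
lemma3p4 p _ σ rewrite +-comm p 1 = ⇔.trans (𝒞⇔Stage p ≤-refl σ) (stage-final⇔ σ)
  where open Antipodes p
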